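{- For all formulas $\varphi,\psi\in\mathcal{L}(\nabla,\bullet)$, the formula $\Delta\varphi\land\varphi\to\circ(\psi\to\varphi)$ is true at every state of every model based on a reflexive frame.
   Context: Fix a nonempty set $\mathbf{P}$ of propositional variables. $\mathcal{L}(\nabla,\bullet)$: $\varphi::=p\mid\neg\varphi\mid\varphi\land\varphi\mid\nabla\varphi\mid\bullet\varphi$ ($p\in\mathbf{P}$), with $\Delta\varphi:=\neg\nabla\varphi$, $\circ\varphi:=\neg\bullet\varphi$. A frame is $\langle S,R\rangle$ with $S$ nonempty and $R\subseteq S\times S$ (reflexive: $xRx$ for all $x$); a model adds $V:\mathbf{P}\to\mathcal{P}(S)$. Truth: $\mathcal{M},s\vDash p$ iff $s\in V(p)$; Booleans as usual; $\mathcal{M},s\vDash\nabla\varphi$ iff there are $t,u$ with $sRt$, $sRu$, $\mathcal{M},t\vDash\varphi$, $\mathcal{M},u\nvDash\varphi$; $\mathcal{M},s\vDash\bullet\varphi$ iff $\mathcal{M},s\vDash\varphi$ and some $t$ with $sRt$ has $\mathcal{M},t\nvDash\varphi$. -}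

module Defs where

open import Data.Product using (_×_; Σ; ∃-syntax; _,_)
open import Relation.Nullary using (¬_)

data Form (P : Set) : Set where
  var : P → Form P
  ¬'_ : Form P → Form P
  _∧'_ : Form P → Form P → Form P
  ∇ : Form P → Form P
  ● : Form P → Form P

module _ {P : Set} where
  Δ : Form P → Form P
  Δ φ = ¬' (∇ φ)

  ∘' : Form P → Form P
  ∘' φ = ¬' (● φ)

  _⇒'_ : Form P → Form P → Form P
  φ ⇒' ψ = ¬' (φ ∧' (¬' ψ))

record Frame : Set₁ where
  field
    S : Set
    R : S → S → Set

Reflexive : Frame → Set
Reflexive F = ∀ x → Frame.R F x x

record Model (P : Set) : Set₁ where
  field
    frame : Frame
    V : P → Frame.S frame → Set
  open Frame frame public

_,_⊨_ : {P : Set} (M : Model P) → Model.S M → Form P → Set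
M , s ⊨ var p = Model.V M p s
M , s ⊨ (¬' φ) = ¬ (M , s ⊨ φ)
M , s ⊨ (φ ∧' ψ) = (M , s ⊨ φ) × (M , s ⊨ ψ)
M , s ⊨ ∇ φ = ∃[ t ] ∃[ u ] (Model.R M s t × Model.R M s u × (M , t ⊨ φ) × ¬ (M , u ⊨ φ))
M , s ⊨ ● φ = (M , s ⊨ φ) × ∃[ t ] (Model.R M s t × ¬ (M , t ⊨ φ))

-- If φ holds at s and is not contingent there, then no successor t refutes φ: otherwise s
-- itself (by reflexivity) and t would witness ∇φ. A successor refuting ψ → φ refutes φ, so
-- •(ψ → φ) fails at s.
module Submission where

open import Defs
open import Data.Product using (_,_)
open import Relation.Nullary using (¬_)

module _ {P : Set} (M : Model P) where
  open Model M using (R)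

  Δ∧⊨⇒successor-¬¬⊨ : Reflexive (Model.frame M) → ∀ {s t} (φ : Form P) →
    M , s ⊨ Δ φ → M , s ⊨ φ → R s t → ¬ ¬ (M , t ⊨ φ)
  Δ∧⊨⇒successor-¬¬⊨ refl {s} {t} φ ¬∇φ φs sRt ¬φt = ¬∇φ (s , t , refl s , sRt , φs , ¬φt)

  ¬¬⊨⇒⊨-⇒' : ∀ {t} (ψ φ : Form P) → ¬ ¬ (M , t ⊨ φ) → M , t ⊨ (ψ ⇒' φ)
  ¬¬⊨⇒⊨-⇒' ψ φ ¬¬φ (_ , ¬φ) = ¬¬φ ¬φ

mainTheorem14 : (P : Set) → P → (φ ψ : Form P) (M : Model P) →
    Reflexive (Model.frame M) → (s : Model.S M) →
    M , s ⊨ ((Δ φ ∧' φ) ⇒' ∘' (ψ ⇒' φ))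
mainTheorem14 P _ φ ψ M refl s ((¬∇φ , φs) , •ψ⇒φ) = •ψ⇒φ λ { (_ , t , sRt , ¬ψ⇒φt) →
  ¬ψ⇒φt (¬¬⊨⇒⊨-⇒' M ψ φ (Δ∧⊨⇒successor-¬¬⊨ M refl φ ¬∇φ φs sRt)) }
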